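{- Let $S$ be a nonempty subset of the positive integers $\mathbb{P}$. For $d\ge1$ define $Y_{S,d}=\sum_\kappa x_{\kappa(1)}x_{\kappa(2)}\cdots x_{\kappa(d)}$, summed over all maps $\kappa\colon[d]\to\mathbb{P}$ such that every part of $\mathrm{type}(\kappa)$ belongs to $S$. Then the sequence $\left(1,\frac{Y_{S,1}}{1!},\frac{Y_{S,2}}{2!},\dots\right)$ is a sprout sequence with seed $\sum_{j\in S}\frac{t^j}{j!}$ (with constant term $1$ added, i.e. seed $1+\sum_{j\in S}t^j/j!$ as a series with constant term 1).
   Context: $[d]=\{1,\dots,d\}$. For $\kappa\colon[d]\to\mathbb{P}$, $\mathrm{type}(\kappa)$ is the partition of $d$ whose parts are the nonzero numbers $\#\kappa^{ -1}(1),\#\kappa^{ -1}(2),\dots$ in weakly decreasing order. A sequence $(R_0=1,R_1,R_2,\dots)$ of symmetric functions (over a field of characteristic 0, in $\boldsymbol{x}=(x_1,x_2,\dots)$) is a sprout sequence with seed $F(t)=1+a_1t+a_2t^2+\cdots$ if $\sum_{n\ge0}R_nt^n=\prod_{i\ge1}F(x_it)$. -}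

module Defs where

open import Data.Bool using (Bool; true; false; if_then_else_; _∧_)
open import Data.Nat as ℕ using (ℕ; zero; suc; _∸_; _!; _≡ᵇ_)
open import Data.Nat.Properties using (_!≢0)
open import Data.Integer using (+_)
open import Data.Fin as Fin using (Fin)
open import Data.Fin.Properties using () renaming (_≟_ to _≟ᶠ_)
open import Data.Vec as Vec using (Vec; []; _∷_; tabulate; zipWith)
open import Data.Vec.Properties using (≡-dec)
open import Data.List as List using (List; []; _∷_; concatMap; allFin; upTo; foldr)
open import Data.Nat.ListAction using (sum)
open import Data.Rational using (ℚ; 0ℚ; 1ℚ; _+_; _*_; _/_)
open import Relation.Nullary.Decidable using (does)
open import Data.Nat.Properties using () renaming (_≟_ to _≟ℕ_)

-- Symmetric functions are represented through their specialisations to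
-- finitely many variables x₁,…,x_m (x_i = 0 for i > m).

Series : ℕ → Set
Series k = Vec ℕ k → ℚ

SymFn : Set
SymFn = (m : ℕ) → Series m

oneSer : (k : ℕ) → Series k
oneSer k α = if does (≡-dec _≟ℕ_ α (Vec.replicate k 0)) then 1ℚ else 0ℚ

sumℚ : List ℚ → ℚ
sumℚ = foldr _+_ 0ℚ

below : {k : ℕ} → Vec ℕ k → List (Vec ℕ k)
below []      = [] ∷ []
below (g ∷ γ) = concatMap (λ b → List.map (b ∷_) (below γ)) (upTo (suc g))

mulSer : {k : ℕ} → Series k → Series k → Series k
mulSer f g γ = sumℚ (List.map (λ β → f β * g (zipWith _∸_ γ β)) (below γ))

-- Sprout sequences.  A seed F(t) = Σ_j a_j t^j is given by its coefficient
-- sequence a.  We work in variables (t, x₁, …, x_m): an exponent vector is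
-- n ∷ α, meaning t^n x^α.

-- the series F(x_i t) in variables (t, x₁,…,x_m)
seedAt : (a : ℕ → ℚ) (m : ℕ) (i : Fin m) → Series (suc m)
seedAt a m i (n ∷ α) =
  if does (≡-dec _≟ℕ_ α (tabulate (λ k → if does (k ≟ᶠ i) then n else 0)))
  then a n else 0ℚ

prodSeed : (a : ℕ → ℚ) (m : ℕ) → Series (suc m)
prodSeed a m = foldr mulSer (oneSer (suc m)) (List.map (seedAt a m) (allFin m))

genFun : (R : ℕ → SymFn) (m : ℕ) → Series (suc m)
genFun R m (n ∷ α) = R n m α

IsSproutSeq : (R : ℕ → SymFn) (a : ℕ → ℚ) → Set
IsSproutSeq R a =
  (a 0 ≡ 1ℚ) × ((m : ℕ) (α : Vec ℕ m) → R 0 m α ≡ oneSer m α)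
  × ((m : ℕ) (γ : Vec ℕ (suc m)) → genFun R m γ ≡ prodSeed a m γ)
  where
  open import Relation.Binary.PropositionalEquality using (_≡_)
  open import Data.Product using (_×_)

allMaps : (d m : ℕ) → List (Vec (Fin m) d)
allMaps zero    m = [] ∷ []
allMaps (suc d) m = concatMap (λ i → List.map (i ∷_) (allMaps d m)) (allFin m)

preimageSize : {d m : ℕ} → Vec (Fin m) d → Fin m → ℕ
preimageSize []      i = 0
preimageSize (j ∷ κ) i = (if does (j ≟ᶠ i) then 1 else 0) ℕ.+ preimageSize κ i

content : {d m : ℕ} → Vec (Fin m) d → Vec ℕ m
content κ = tabulate (preimageSize κ)

typeIn : (S : ℕ → Bool) {d m : ℕ} → Vec (Fin m) d → Bool
typeIn S κ = Vec.foldr _ (λ c b → (if c ≡ᵇ 0 then true else S c) ∧ b) true (content κ)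

Ycoeff : (S : ℕ → Bool) (d m : ℕ) → Vec ℕ m → ℕ
Ycoeff S d m α = sum (List.map
  (λ κ → if typeIn S κ ∧ does (≡-dec _≟ℕ_ (content κ) α) then 1 else 0)
  (allMaps d m))

Yseq : (S : ℕ → Bool) → ℕ → SymFn
Yseq S zero    m α = oneSer m α
Yseq S (suc d) m α = (+ Ycoeff S (suc d) m α) / (suc d !) where instance _ = suc d !≢0

seedS : (S : ℕ → Bool) → ℕ → ℚ
seedS S zero    = 1ℚ
seedS S (suc j) = if S (suc j) then (+ 1) / (suc j !) else 0ℚ
  where instance _ = suc j !≢0

{-# OPTIONS --safe #-}
-- The coefficient of t^n x^α in ∏ᵢ F(xᵢ t) is [n = |α|] ∏ᵢ a_{αᵢ}, by induction on the number of
-- variables: the factor F(x₁ t) = Σⱼ aⱼ x₁ʲ tʲ ties the exponent of x₁ to its share of that of t.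
-- For the seed 1 + Σ_{j∈S} tʲ/j! this is [n = |α|] [every nonzero αᵢ lies in S] / α!.
-- On the other side, whether κ contributes to Y_{S,n} depends only on its content α, and the number
-- of κ : [n] → [m] with content α is n!/α! when n = |α|: splitting off κ(1) gives the recurrence
-- #(α) · α! = Σᵢ αᵢ · #(α − eᵢ) · (α − eᵢ)! = |α| · (n − 1)!.
module Submission where

open import Defs
open import Algebra.Bundles using (Semiring; Ring)
open import Data.Bool using (Bool; true; false; if_then_else_; _∧_; T)
open import Data.Bool.Properties using (if-∧; if-eta; ∧-zeroʳ)
open import Data.Nat as ℕ using (ℕ; zero; suc; _∸_; _!; _≡ᵇ_; _<ᵇ_)
import Data.Nat.Properties as ℕP
open import Algebra.Properties.CommutativeSemigroup ℕP.*-commutativeSemigroup using (x∙yz≈y∙xz)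
open import Data.Fin as Fin using (Fin; zero; suc)
open import Data.Vec as Vec using (Vec; []; _∷_; zipWith; _[_]%=_; lookup)
open import Data.Vec.Properties using (≡-dec)
open import Data.List as List using (List; []; _∷_; _++_; concatMap; upTo; allFin; foldr)
import Data.List.Properties as ListP
open import Data.Rational using (ℚ; 0ℚ; 1ℚ; _/_)
import Data.Rational as ℚ
import Data.Rational.Properties as ℚP
open import Data.Rational.Unnormalised using (mkℚᵘ; *≡*)
import Data.Rational.Unnormalised as ℚᵘ
import Data.Rational.Unnormalised.Properties as ℚᵘP
open import Data.Integer using (+_)
import Data.Integer.Properties as ℤP
open import Data.Product using (∃; _,_)
open import Function using (_∘_)
open import Relation.Binary.Definitions using (DecidableEquality)
open import Relation.Nullary.Decidable using (does; yes; no)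
open import Relation.Binary.PropositionalEquality
  using (_≡_; refl; sym; trans; cong; cong₂; subst; _≗_; module ≡-Reasoning)

module FiniteSum {c ℓ} (R : Semiring c ℓ) where

  open Semiring R
    using ( Carrier; _≈_; _+_; _*_; 0#; reflexive; +-cong; +-congˡ
          ; +-identityˡ; +-identityʳ; +-assoc; zeroˡ; distribʳ )
    renaming (refl to ≈-refl; sym to ≈-sym; trans to ≈-trans)

  ∑ : {B : Set} → List B → (B → Carrier) → Carrier
  ∑ xs f = foldr _+_ 0# (List.map f xs)

  infix 5 ∑
  syntax ∑ xs (λ x → e) = ∑[ x ∈ xs ] e

  module _ {B : Set} where

    ∑-cong : (xs : List B) {f g : B → Carrier} → (∀ x → f x ≈ g x) → ∑ xs f ≈ ∑ xs g
    ∑-cong []       f≈g = ≈-refl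
    ∑-cong (x ∷ xs) f≈g = +-cong (f≈g x) (∑-cong xs f≈g)

    ∑-zero : (xs : List B) {f : B → Carrier} → (∀ x → f x ≈ 0#) → ∑ xs f ≈ 0#
    ∑-zero []       f≈0 = ≈-refl
    ∑-zero (x ∷ xs) f≈0 = ≈-trans (+-cong (f≈0 x) (∑-zero xs f≈0)) (+-identityˡ 0#)

    ∑-++ : (xs ys : List B) (f : B → Carrier) → ∑ (xs ++ ys) f ≈ ∑ xs f + ∑ ys f
    ∑-++ []       ys f = ≈-sym (+-identityˡ _)
    ∑-++ (x ∷ xs) ys f = ≈-trans (+-congˡ (∑-++ xs ys f)) (≈-sym (+-assoc _ _ _))

    ∑-map : {C : Set} (h : C → B) (xs : List C) (f : B → Carrier) →
            ∑ (List.map h xs) f ≡ ∑[ x ∈ xs ] f (h x)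
    ∑-map h xs f = cong (foldr _+_ 0#) (sym (ListP.map-∘ xs))

    ∑-concatMap : {C : Set} (g : C → List B) (xs : List C) (f : B → Carrier) →
                  ∑ (concatMap g xs) f ≈ ∑[ x ∈ xs ] ∑ (g x) f
    ∑-concatMap g []       f = ≈-refl
    ∑-concatMap g (x ∷ xs) f =
      ≈-trans (∑-++ (g x) (concatMap g xs) f) (+-congˡ (∑-concatMap g xs f))

    ∑-if : (b : Bool) (xs : List B) (f : B → Carrier) →
           ∑[ x ∈ xs ] (if b then f x else 0#) ≈ (if b then ∑ xs f else 0#)
    ∑-if true  xs f = ≈-refl
    ∑-if false xs f = ∑-zero xs (λ _ → ≈-refl)

    ∑-distribʳ : (xs : List B) (f : B → Carrier) (a : Carrier) →
                 ∑ xs f * a ≈ ∑[ x ∈ xs ] (f x * a)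
    ∑-distribʳ []       f a = zeroˡ a
    ∑-distribʳ (x ∷ xs) f a = ≈-trans (distribʳ a (f x) (∑ xs f)) (+-congˡ (∑-distribʳ xs f a))

  ∑-upTo-suc : (n : ℕ) (f : ℕ → Carrier) →
               ∑ (upTo (suc n)) f ≡ f 0 + (∑[ k ∈ upTo n ] f (suc k))
  ∑-upTo-suc n f = cong (λ ys → f 0 + foldr _+_ 0# ys)
    (trans (ListP.map-applyUpTo suc f n) (sym (ListP.map-upTo (f ∘ suc) n)))

  ∑-allFin-suc : (m : ℕ) (f : Fin (suc m) → Carrier) →
                 ∑ (allFin (suc m)) f ≡ f zero + (∑[ i ∈ allFin m ] f (suc i))
  ∑-allFin-suc m f = cong (λ ys → f zero + foldr _+_ 0# ys)
    (trans (ListP.map-tabulate suc f) (sym (ListP.map-tabulate (λ i → i) (f ∘ suc))))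

  ∑-upTo-δ : (n b : ℕ) (f : ℕ → Carrier) →
             ∑[ k ∈ upTo n ] (if k ≡ᵇ b then f k else 0#) ≈ (if b <ᵇ n then f b else 0#)
  ∑-upTo-δ zero    b       f = ≈-refl
  ∑-upTo-δ (suc n) zero    f = ≈-trans (reflexive (∑-upTo-suc n _))
    (≈-trans (+-congˡ (∑-zero (upTo n) (λ _ → ≈-refl))) (+-identityʳ (f 0)))
  ∑-upTo-δ (suc n) (suc b) f = ≈-trans (reflexive (∑-upTo-suc n _))
    (≈-trans (+-identityˡ _) (∑-upTo-δ n b (f ∘ suc)))

infix 4 _≟ᵛ_

_≟ᵛ_ : ∀ {k} → DecidableEquality (Vec ℕ k)
_≟ᵛ_ = ≡-dec ℕP._≟_

-- Written with tabulate, not replicate, since this is the form seedAt's exponent vector reduces to.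
zeros : ∀ {k} → Vec ℕ k
zeros = Vec.tabulate (λ _ → 0)

zipWith-∸-zeros : ∀ {k} (α : Vec ℕ k) → zipWith _∸_ α zeros ≡ α
zipWith-∸-zeros []      = refl
zipWith-∸-zeros (x ∷ α) = cong (x ∷_) (zipWith-∸-zeros α)

module _ where

  open FiniteSum (Ring.semiring ℚP.+-*-ring)
  open import Data.Rational using (_+_; _*_)

  ∑-below-∷ : ∀ {k} g (γ : Vec ℕ k) (F : Vec ℕ (suc k) → ℚ) →
              ∑ (below (g ∷ γ)) F ≡ ∑[ b ∈ upTo (suc g) ] ∑[ β ∈ below γ ] F (b ∷ β)
  ∑-below-∷ g γ F = trans (∑-concatMap (λ b → List.map (b ∷_) (below γ)) (upTo (suc g)) F)
                          (∑-cong (upTo (suc g)) (λ b → ∑-map (b ∷_) (below γ) F))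

  ∑-below-zeros : ∀ {k} (α : Vec ℕ k) (h : Vec ℕ k → ℚ) →
                  ∑[ δ ∈ below α ] (if does (δ ≟ᵛ zeros) then h δ else 0ℚ) ≡ h zeros
  ∑-below-zeros []      h = ℚP.+-identityʳ (h [])
  ∑-below-zeros (x ∷ α) h = begin
      ∑[ δ ∈ below (x ∷ α) ] (if does (δ ≟ᵛ zeros) then h δ else 0ℚ)
    ≡⟨ ∑-below-∷ x α (λ δ → if does (δ ≟ᵛ zeros) then h δ else 0ℚ) ⟩
      ∑[ b ∈ upTo (suc x) ] row b
    ≡⟨ ∑-upTo-suc x row ⟩
      row 0 + (∑[ b ∈ upTo x ] row (suc b))
    ≡⟨ cong₂ _+_ (∑-below-zeros α (h ∘ (0 ∷_)))
                 (∑-zero (upTo x) (λ _ → ∑-zero (below α) (λ _ → refl))) ⟩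
      h zeros + 0ℚ
    ≡⟨ ℚP.+-identityʳ (h zeros) ⟩
      h zeros ∎
    where
    open ≡-Reasoning
    row : ℕ → ℚ
    row b = ∑[ δ ∈ below α ] (if does (b ∷ δ ≟ᵛ zeros) then h (b ∷ δ) else 0ℚ)

  liftSeries : ∀ {m} → Series (suc m) → Series (suc (suc m))
  liftSeries f (n ∷ zero  ∷ α) = f (n ∷ α)
  liftSeries f (n ∷ suc _ ∷ α) = 0ℚ

  liftSeries-cong : ∀ {m} {f g : Series (suc m)} → f ≗ g → liftSeries f ≗ liftSeries g
  liftSeries-cong f≗g (n ∷ zero  ∷ α) = f≗g (n ∷ α)
  liftSeries-cong f≗g (n ∷ suc _ ∷ α) = refl

  oneSer-lift : ∀ {m} → oneSer (suc (suc m)) ≗ liftSeries (oneSer (suc m))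
  oneSer-lift (n       ∷ zero  ∷ α) = refl
  oneSer-lift (zero    ∷ suc _ ∷ α) = refl
  oneSer-lift (suc n   ∷ suc _ ∷ α) = refl

  seedAt-suc : ∀ {m} a (i : Fin m) → seedAt a (suc m) (suc i) ≗ liftSeries (seedAt a m i)
  seedAt-suc a i (n ∷ zero  ∷ α) = refl
  seedAt-suc a i (n ∷ suc _ ∷ α) = refl

  mulSer-cong : ∀ {k} {f f′ g g′ : Series k} →
                f ≗ f′ → g ≗ g′ → mulSer f g ≗ mulSer f′ g′
  mulSer-cong f≗f′ g≗g′ γ = ∑-cong (below γ) (λ β → cong₂ _*_ (f≗f′ β) (g≗g′ _))

  mulSer-congʳ : ∀ {k} (f : Series k) {g g′ : Series k} → g ≗ g′ → mulSer f g ≗ mulSer f g′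
  mulSer-congʳ f = mulSer-cong {f = f} (λ _ → refl)

  mulSer-lift : ∀ {m} (f g : Series (suc m)) →
                mulSer (liftSeries f) (liftSeries g) ≗ liftSeries (mulSer f g)
  mulSer-lift f g (N ∷ zero ∷ α) = begin
      mulSer (liftSeries f) (liftSeries g) (N ∷ 0 ∷ α)
    ≡⟨ ∑-below-∷ N (0 ∷ α) _ ⟩
      ∑[ n ∈ upTo (suc N) ] ∑[ β ∈ below (0 ∷ α) ] F (n ∷ β)
    ≡⟨ ∑-cong (upTo (suc N)) (λ n → trans (∑-below-∷ 0 α (F ∘ (n ∷_)))
                                          (ℚP.+-identityʳ (G n))) ⟩
      ∑[ n ∈ upTo (suc N) ] G n
    ≡⟨ sym (∑-below-∷ N α (λ β → f β * g (zipWith _∸_ (N ∷ α) β))) ⟩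
      mulSer f g (N ∷ α) ∎
    where
    open ≡-Reasoning
    F : Vec ℕ _ → ℚ
    F β = liftSeries f β * liftSeries g (zipWith _∸_ (N ∷ 0 ∷ α) β)
    G : ℕ → ℚ
    G n = ∑[ δ ∈ below α ] (f (n ∷ δ) * g (N ∸ n ∷ zipWith _∸_ α δ))
  mulSer-lift f g (N ∷ suc b ∷ α) = ∑-zero (below (N ∷ suc b ∷ α)) vanish
    where
    vanish : ∀ β → liftSeries f β * liftSeries g (zipWith _∸_ (N ∷ suc b ∷ α) β) ≡ 0ℚ
    vanish (n ∷ zero  ∷ δ) = ℚP.*-zeroʳ (f (n ∷ δ))
    vanish (n ∷ suc c ∷ δ) = ℚP.*-zeroˡ (liftSeries g (N ∸ n ∷ b ∸ c ∷ zipWith _∸_ α δ))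

  prodSeed-lift : ∀ {m} a (is : List (Fin m)) →
    foldr mulSer (oneSer _) (List.map (seedAt a (suc m) ∘ suc) is)
      ≗ liftSeries (foldr mulSer (oneSer _) (List.map (seedAt a m) is))
  prodSeed-lift a []       = oneSer-lift
  prodSeed-lift a (i ∷ is) γ =
    trans (mulSer-cong (seedAt-suc a i) (prodSeed-lift a is) γ) (mulSer-lift _ _ γ)

  prodSeed-suc : ∀ a m → prodSeed a (suc m) ≗ mulSer (seedAt a (suc m) zero) (liftSeries (prodSeed a m))
  prodSeed-suc a m γ = trans
    (cong (λ fs → foldr mulSer (oneSer _) (seedAt a (suc m) zero ∷ fs) γ)
          (trans (ListP.map-tabulate suc (seedAt a (suc m)))
                 (sym (ListP.map-tabulate (λ i → i) (seedAt a (suc m) ∘ suc)))))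
    (mulSer-congʳ (seedAt a (suc m) zero) (prodSeed-lift a (allFin m)) γ)

  coeffProduct : ∀ {k} → (ℕ → ℚ) → Vec ℕ k → ℚ
  coeffProduct a []      = 1ℚ
  coeffProduct a (x ∷ α) = a x * coeffProduct a α

  prodSeedClosed : (ℕ → ℚ) → ∀ {m} → Series (suc m)
  prodSeedClosed a (n ∷ α) = if n ≡ᵇ Vec.sum α then coeffProduct a α else 0ℚ

  if-* : ∀ b (x y : ℚ) → (if b then x else 0ℚ) * y ≡ (if b then x * y else 0ℚ)
  if-* true  x y = refl
  if-* false x y = ℚP.*-zeroˡ y

  *-if : ∀ b (x y : ℚ) → x * (if b then y else 0ℚ) ≡ (if b then x * y else 0ℚ)
  *-if true  x y = refl
  *-if false x y = ℚP.*-zeroʳ x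

  if-∧-* : ∀ p q (x y : ℚ) →
           (if p ∧ q then x else 0ℚ) * y ≡ (if q then (if p then x else 0ℚ) * y else 0ℚ)
  if-∧-* true  q     x y = if-* q x y
  if-∧-* false true  x y = refl
  if-∧-* false false x y = ℚP.*-zeroˡ y

  liftSeries-∸ : ∀ {m} (G : Series (suc m)) (x : ℚ) M n b (α : Vec ℕ m) →
    (if n <ᵇ suc b then x * liftSeries G (M ∷ b ∸ n ∷ α) else 0ℚ)
      ≡ (if n ≡ᵇ b then x * G (M ∷ α) else 0ℚ)
  liftSeries-∸ G x M zero    zero    α = refl
  liftSeries-∸ G x M zero    (suc b) α = ℚP.*-zeroʳ x
  liftSeries-∸ G x M (suc n) zero    α = refl
  liftSeries-∸ G x M (suc n) (suc b) α = liftSeries-∸ G x M n b α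

  if-∸-≡ᵇ : (x P : ℚ) (s b N : ℕ) →
    (if b <ᵇ suc N then x * (if N ∸ b ≡ᵇ s then P else 0ℚ) else 0ℚ)
      ≡ (if N ≡ᵇ b ℕ.+ s then x * P else 0ℚ)
  if-∸-≡ᵇ x P s zero    N       = *-if (N ≡ᵇ s) x P
  if-∸-≡ᵇ x P s (suc b) zero    = refl
  if-∸-≡ᵇ x P s (suc b) (suc N) = if-∸-≡ᵇ x P s b N

  mulSer-seedAt-zero : ∀ {m} a →
    mulSer (seedAt a (suc m) zero) (liftSeries (prodSeedClosed a)) ≗ prodSeedClosed a
  mulSer-seedAt-zero {m} a (N ∷ b ∷ α) = begin
      mulSer (seedAt a (suc m) zero) C↑ (N ∷ b ∷ α)
    ≡⟨ ∑-below-∷ N (b ∷ α) F ⟩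
      ∑[ n ∈ upTo (suc N) ] ∑[ β ∈ below (b ∷ α) ] F (n ∷ β)
    ≡⟨ ∑-cong (upTo (suc N)) (λ n → trans (∑-below-∷ b α (F ∘ (n ∷_)))
                                          (∑-cong (upTo (suc b)) (collapse-δ n))) ⟩
      ∑[ n ∈ upTo (suc N) ] ∑[ c ∈ upTo (suc b) ] term n c
    ≡⟨ ∑-cong (upTo (suc N)) collapse-c ⟩
      ∑[ n ∈ upTo (suc N) ] (if n ≡ᵇ b then a n * C (N ∸ n ∷ α) else 0ℚ)
    ≡⟨ ∑-upTo-δ (suc N) b (λ n → a n * C (N ∸ n ∷ α)) ⟩
      (if b <ᵇ suc N then a b * C (N ∸ b ∷ α) else 0ℚ)
    ≡⟨ if-∸-≡ᵇ (a b) (coeffProduct a α) (Vec.sum α) b N ⟩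
      prodSeedClosed a (N ∷ b ∷ α) ∎
    where
    open ≡-Reasoning
    C : Series (suc m)
    C = prodSeedClosed a
    C↑ : Series (suc (suc m))
    C↑ = liftSeries C
    F : Vec ℕ (suc (suc m)) → ℚ
    F β = seedAt a (suc m) zero β * C↑ (zipWith _∸_ (N ∷ b ∷ α) β)
    a[_≡_] : ℕ → ℕ → ℚ
    a[ c ≡ n ] = if c ≡ᵇ n then a n else 0ℚ
    term : ℕ → ℕ → ℚ
    term n c = a[ c ≡ n ] * C↑ (N ∸ n ∷ b ∸ c ∷ α)
    collapse-δ : ∀ n c → ∑[ δ ∈ below α ] F (n ∷ c ∷ δ) ≡ term n c
    collapse-δ n c = begin
        ∑[ δ ∈ below α ] F (n ∷ c ∷ δ)
      ≡⟨ ∑-cong (below α) (λ δ → if-∧-* (c ≡ᵇ n) (does (δ ≟ᵛ zeros)) (a n) (C↑ (N′ δ))) ⟩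
        ∑[ δ ∈ below α ] (if does (δ ≟ᵛ zeros) then a[ c ≡ n ] * C↑ (N′ δ) else 0ℚ)
      ≡⟨ ∑-below-zeros α (λ δ → a[ c ≡ n ] * C↑ (N′ δ)) ⟩
        a[ c ≡ n ] * C↑ (N′ zeros)
      ≡⟨ cong (λ δ → a[ c ≡ n ] * C↑ (N ∸ n ∷ b ∸ c ∷ δ)) (zipWith-∸-zeros α) ⟩
        term n c ∎
      where
      N′ : Vec ℕ m → Vec ℕ (suc (suc m))
      N′ δ = N ∸ n ∷ b ∸ c ∷ zipWith _∸_ α δ
    collapse-c : ∀ n → ∑[ c ∈ upTo (suc b) ] term n c ≡ (if n ≡ᵇ b then a n * C (N ∸ n ∷ α) else 0ℚ)
    collapse-c n = begin
        ∑[ c ∈ upTo (suc b) ] term n c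
      ≡⟨ ∑-cong (upTo (suc b)) (λ c → if-* (c ≡ᵇ n) (a n) (C↑ (N ∸ n ∷ b ∸ c ∷ α))) ⟩
        ∑[ c ∈ upTo (suc b) ] (if c ≡ᵇ n then a n * C↑ (N ∸ n ∷ b ∸ c ∷ α) else 0ℚ)
      ≡⟨ ∑-upTo-δ (suc b) n (λ c → a n * C↑ (N ∸ n ∷ b ∸ c ∷ α)) ⟩
        (if n <ᵇ suc b then a n * C↑ (N ∸ n ∷ b ∸ n ∷ α) else 0ℚ)
      ≡⟨ liftSeries-∸ C (a n) (N ∸ n) n b α ⟩
        (if n ≡ᵇ b then a n * C (N ∸ n ∷ α) else 0ℚ) ∎

  prodSeed-closed : ∀ a m → prodSeed a m ≗ prodSeedClosed a
  prodSeed-closed a zero    (zero  ∷ []) = refl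
  prodSeed-closed a zero    (suc _ ∷ []) = refl
  prodSeed-closed a (suc m) γ = trans (prodSeed-suc a m γ)
    (trans (mulSer-congʳ (seedAt a (suc m) zero) (liftSeries-cong (prodSeed-closed a m)) γ)
           (mulSer-seedAt-zero a γ))

  oneSer-closed : ∀ {a} → a 0 ≡ 1ℚ → ∀ {m} (α : Vec ℕ m) →
                  oneSer m α ≡ prodSeedClosed a (0 ∷ α)
  oneSer-closed a₀ []          = refl
  oneSer-closed {a} a₀ (zero ∷ α) = trans (oneSer-closed a₀ α)
    (cong (λ v → if 0 ≡ᵇ Vec.sum α then v else 0ℚ)
          (sym (trans (cong (_* coeffProduct a α) a₀) (ℚP.*-identityˡ (coeffProduct a α)))))
  oneSer-closed a₀ (suc _ ∷ α) = refl

_!ᵛ : ∀ {k} → Vec ℕ k → ℕ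
[]      !ᵛ = 1
(x ∷ α) !ᵛ = x ! ℕ.* α !ᵛ

!ᵛ≢0 : ∀ {k} (α : Vec ℕ k) → ℕ.NonZero (α !ᵛ)
!ᵛ≢0 []      = _
!ᵛ≢0 (x ∷ α) = ℕP.m*n≢0 (x !) (α !ᵛ) {{ x ℕP.!≢0 }} {{ !ᵛ≢0 α }}

!ᵛ-pred : ∀ {m k} (i : Fin m) (α : Vec ℕ m) → lookup α i ≡ suc k →
          α !ᵛ ≡ suc k ℕ.* (α [ i ]%= ℕ.pred) !ᵛ
!ᵛ-pred         zero    (suc x ∷ α) refl = ℕP.*-assoc (suc x) (x !) (α !ᵛ)
!ᵛ-pred {k = k} (suc i) (x ∷ α)     eq   =
  trans (cong (x ! ℕ.*_) (!ᵛ-pred i α eq)) (x∙yz≈y∙xz (x !) (suc k) ((α [ i ]%= ℕ.pred) !ᵛ))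

sum-pred : ∀ {m k} (i : Fin m) (α : Vec ℕ m) → lookup α i ≡ suc k →
           Vec.sum α ≡ suc (Vec.sum (α [ i ]%= ℕ.pred))
sum-pred zero    (suc x ∷ α) refl = refl
sum-pred (suc i) (x ∷ α)     eq   = trans (cong (x ℕ.+_) (sum-pred i α eq)) (ℕP.+-suc x _)

tabulate-δ-+ : ∀ {m} (i : Fin m) (f : Fin m → ℕ) →
  Vec.tabulate (λ k → (if does (i Fin.≟ k) then 1 else 0) ℕ.+ f k) ≡ Vec.tabulate f [ i ]%= suc
tabulate-δ-+ zero    f = refl
tabulate-δ-+ (suc i) f = cong (f zero ∷_) (tabulate-δ-+ i (f ∘ suc))

content-∷ : ∀ {d m} (i : Fin m) (κ : Vec (Fin m) d) → content (i ∷ κ) ≡ content κ [ i ]%= suc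
content-∷ i κ = tabulate-δ-+ i (preimageSize κ)

[]%=suc-≟ᵛ : ∀ {m} (i : Fin m) (w α : Vec ℕ m) →
  does (w [ i ]%= suc ≟ᵛ α) ≡ (0 <ᵇ lookup α i) ∧ does (w ≟ᵛ α [ i ]%= ℕ.pred)
[]%=suc-≟ᵛ zero    (y ∷ w) (zero  ∷ α) = refl
[]%=suc-≟ᵛ zero    (y ∷ w) (suc x ∷ α) = refl
[]%=suc-≟ᵛ (suc i) (y ∷ w) (x ∷ α) with y ≡ᵇ x
... | true  = []%=suc-≟ᵛ i w α
... | false = sym (∧-zeroʳ (0 <ᵇ lookup α i))

partsIn : (ℕ → Bool) → ∀ {k} → Vec ℕ k → Bool
partsIn S = Vec.foldr _ (λ c b → (if c ≡ᵇ 0 then true else S c) ∧ b) true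

module _ where

  open FiniteSum ℕP.+-*-semiring
  open import Data.Nat using (_+_; _*_)

  countMaps : (d : ℕ) {m : ℕ} → Vec ℕ m → ℕ
  countMaps d {m} α = ∑[ κ ∈ allMaps d m ] (if does (content κ ≟ᵛ α) then 1 else 0)

  countMaps-suc : ∀ d {m} (α : Vec ℕ m) →
    countMaps (suc d) α
      ≡ ∑[ i ∈ allFin m ] (if 0 <ᵇ lookup α i then countMaps d (α [ i ]%= ℕ.pred) else 0)
  countMaps-suc d {m} α = trans
    (∑-concatMap (λ i → List.map (i ∷_) (allMaps d m)) (allFin m) [content≡α])
    (∑-cong (allFin m) (λ i → trans (∑-map (i ∷_) (allMaps d m) [content≡α]) (first-letter i)))
    where
    open ≡-Reasoning
    [content≡α] : ∀ {d} → Vec (Fin m) d → ℕ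
    [content≡α] κ = if does (content κ ≟ᵛ α) then 1 else 0
    first-letter : ∀ i → ∑[ κ ∈ allMaps d m ] [content≡α] (i ∷ κ)
                         ≡ (if 0 <ᵇ lookup α i then countMaps d (α [ i ]%= ℕ.pred) else 0)
    first-letter i = begin
        ∑[ κ ∈ allMaps d m ] [content≡α] (i ∷ κ)
      ≡⟨ ∑-cong (allMaps d m) (λ κ → cong (λ b → if b then 1 else 0)
           (trans (cong (does ∘ (_≟ᵛ α)) (content-∷ i κ)) ([]%=suc-≟ᵛ i (content κ) α))) ⟩
        ∑[ κ ∈ allMaps d m ] (if p ∧ does (content κ ≟ᵛ α [ i ]%= ℕ.pred) then 1 else 0)
      ≡⟨ ∑-cong (allMaps d m) (λ κ → if-∧ p) ⟩
        ∑[ κ ∈ allMaps d m ] (if p then (if does (content κ ≟ᵛ α [ i ]%= ℕ.pred) then 1 else 0) else 0)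
      ≡⟨ ∑-if p (allMaps d m) _ ⟩
        (if p then countMaps d (α [ i ]%= ℕ.pred) else 0) ∎
      where
      p : Bool
      p = 0 <ᵇ lookup α i

  ∑-lookup : ∀ {m} (α : Vec ℕ m) → ∑[ i ∈ allFin m ] lookup α i ≡ Vec.sum α
  ∑-lookup         []      = refl
  ∑-lookup {suc m} (x ∷ α) = trans (∑-allFin-suc m (lookup (x ∷ α))) (cong (_+_ x) (∑-lookup α))

  countMaps-zero : ∀ {m} (α : Vec ℕ m) → countMaps 0 α * α !ᵛ ≡ (if 0 ≡ᵇ Vec.sum α then 1 else 0)
  countMaps-zero []          = refl
  countMaps-zero (zero  ∷ α) =
    trans (cong (countMaps 0 α *_) (ℕP.+-identityʳ (α !ᵛ))) (countMaps-zero α)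
  countMaps-zero (suc _ ∷ α) = refl

  countMaps-multinomial : ∀ d {m} (α : Vec ℕ m) →
                          countMaps d α * α !ᵛ ≡ (if d ≡ᵇ Vec.sum α then d ! else 0)
  countMaps-multinomial zero        α = countMaps-zero α
  countMaps-multinomial (suc d) {m} α = begin
      countMaps (suc d) α * α !ᵛ
    ≡⟨ cong (_* α !ᵛ) (countMaps-suc d α) ⟩
      (∑[ i ∈ allFin m ] t i) * α !ᵛ
    ≡⟨ ∑-distribʳ (allFin m) t (α !ᵛ) ⟩
      ∑[ i ∈ allFin m ] (t i * α !ᵛ)
    ≡⟨ ∑-cong (allFin m) t-weighted ⟩
      ∑[ i ∈ allFin m ] (lookup α i * K)
    ≡⟨ sym (∑-distribʳ (allFin m) (lookup α) K) ⟩
      (∑[ i ∈ allFin m ] lookup α i) * K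
    ≡⟨ cong (_* K) (∑-lookup α) ⟩
      Vec.sum α * K
    ≡⟨ sum-* (Vec.sum α) ⟩
      (if suc d ≡ᵇ Vec.sum α then suc d ! else 0) ∎
    where
    open ≡-Reasoning
    t : Fin m → ℕ
    t i = if 0 <ᵇ lookup α i then countMaps d (α [ i ]%= ℕ.pred) else 0
    K : ℕ
    K = if suc d ≡ᵇ Vec.sum α then d ! else 0
    t-weighted : ∀ i → (if 0 <ᵇ lookup α i then countMaps d (α [ i ]%= ℕ.pred) else 0) * α !ᵛ
                       ≡ lookup α i * K
    t-weighted i with lookup α i in eq
    ... | zero  = refl
    ... | suc k = begin
        countMaps d α′ * α !ᵛ
      ≡⟨ cong (countMaps d α′ *_) (!ᵛ-pred i α eq) ⟩
        countMaps d α′ * (suc k * α′ !ᵛ)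
      ≡⟨ x∙yz≈y∙xz (countMaps d α′) (suc k) (α′ !ᵛ) ⟩
        suc k * (countMaps d α′ * α′ !ᵛ)
      ≡⟨ cong (suc k *_) (countMaps-multinomial d α′) ⟩
        suc k * (if d ≡ᵇ Vec.sum α′ then d ! else 0)
      ≡⟨ cong (λ s → suc k * (if suc d ≡ᵇ s then d ! else 0)) (sym (sum-pred i α eq)) ⟩
        suc k * K ∎
      where
      α′ : Vec ℕ m
      α′ = α [ i ]%= ℕ.pred
    sum-* : ∀ s → s * (if suc d ≡ᵇ s then d ! else 0) ≡ (if suc d ≡ᵇ s then suc d ! else 0)
    sum-* zero    = refl
    sum-* (suc s) with d ≡ᵇ s in eq
    ... | true  = cong (λ n → suc n * d !) (sym (ℕP.≡ᵇ⇒≡ d s (subst T (sym eq) _)))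
    ... | false = ℕP.*-zeroʳ (suc s)

  typeIn-∧-≟ᵛ : ∀ S {d m} (κ : Vec (Fin m) d) (α : Vec ℕ m) →
    typeIn S κ ∧ does (content κ ≟ᵛ α) ≡ partsIn S α ∧ does (content κ ≟ᵛ α)
  typeIn-∧-≟ᵛ S κ α with content κ ≟ᵛ α
  ... | yes refl = refl
  ... | no  _    = trans (∧-zeroʳ (typeIn S κ)) (sym (∧-zeroʳ (partsIn S α)))

  Ycoeff-countMaps : ∀ S d {m} (α : Vec ℕ m) →
                     Ycoeff S d m α ≡ (if partsIn S α then countMaps d α else 0)
  Ycoeff-countMaps S d {m} α = trans
    (∑-cong (allMaps d m) (λ κ → trans (cong (λ b → if b then 1 else 0) (typeIn-∧-≟ᵛ S κ α))
                                       (if-∧ (partsIn S α))))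
    (∑-if (partsIn S α) (allMaps d m) (λ κ → if does (content κ ≟ᵛ α) then 1 else 0))

/-cross : ∀ p q r s .{{_ : ℕ.NonZero q}} .{{_ : ℕ.NonZero s}} →
          p ℕ.* s ≡ r ℕ.* q → (+ p) / q ≡ (+ r) / s
/-cross p (suc q) r (suc s) eq = ℚP.fromℚᵘ-cong {mkℚᵘ (+ p) q} {mkℚᵘ (+ r) s}
  (*≡* (trans (sym (ℤP.pos-* p (suc s))) (trans (cong +_ eq) (ℤP.pos-* r (suc q)))))

/-*-/ : ∀ p q r s .{{_ : ℕ.NonZero q}} .{{_ : ℕ.NonZero s}} →
        ((+ p) / q) ℚ.* ((+ r) / s) ≡ _/_ (+ (p ℕ.* r)) (q ℕ.* s) {{ ℕP.m*n≢0 q s }}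
/-*-/ p (suc q) r (suc s) = ℚP.toℚᵘ-injective (begin
    ℚ.toℚᵘ (((+ p) / suc q) ℚ.* ((+ r) / suc s))
  ≈⟨ ℚP.toℚᵘ-homo-* ((+ p) / suc q) ((+ r) / suc s) ⟩
    ℚ.toℚᵘ ((+ p) / suc q) ℚᵘ.* ℚ.toℚᵘ ((+ r) / suc s)
  ≈⟨ ℚᵘP.*-cong (ℚP.toℚᵘ-fromℚᵘ (mkℚᵘ (+ p) q)) (ℚP.toℚᵘ-fromℚᵘ (mkℚᵘ (+ r) s)) ⟩
    mkℚᵘ (+ p) q ℚᵘ.* mkℚᵘ (+ r) s
  ≡⟨ cong (λ n → mkℚᵘ n d) (sym (ℤP.pos-* p r)) ⟩
    mkℚᵘ (+ (p ℕ.* r)) d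
  ≈⟨ ℚᵘP.≃-sym (ℚP.toℚᵘ-fromℚᵘ (mkℚᵘ (+ (p ℕ.* r)) d)) ⟩
    ℚ.toℚᵘ ((+ (p ℕ.* r)) / (suc q ℕ.* suc s)) ∎)
  where
  open ℚᵘP.≃-Reasoning
  d : ℕ
  d = ℕ.pred (suc q ℕ.* suc s)

1/!ᵛ : ∀ {k} → Vec ℕ k → ℚ
1/!ᵛ α = _/_ (+ 1) (α !ᵛ) {{ !ᵛ≢0 α }}

seedS-coeffProduct : ∀ S {k} (α : Vec ℕ k) →
                     coeffProduct (seedS S) α ≡ (if partsIn S α then 1/!ᵛ α else 0ℚ)
seedS-coeffProduct S []          = refl
seedS-coeffProduct S (zero ∷ α)  =
  trans (ℚP.*-identityˡ _) (trans (seedS-coeffProduct S α) (cong (λ v → if partsIn S α then v else 0ℚ)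
    (ℚP./-cong {+ 1} {{ !ᵛ≢0 α }} {{ !ᵛ≢0 (0 ∷ α) }} refl (sym (ℕP.+-identityʳ (α !ᵛ))))))
seedS-coeffProduct S (suc j ∷ α) with S (suc j)
... | false = ℚP.*-zeroˡ (coeffProduct (seedS S) α)
... | true  = begin
    1/j! ℚ.* coeffProduct (seedS S) α
  ≡⟨ cong (1/j! ℚ.*_) (seedS-coeffProduct S α) ⟩
    1/j! ℚ.* (if partsIn S α then 1/!ᵛ α else 0ℚ)
  ≡⟨ *-if (partsIn S α) 1/j! (1/!ᵛ α) ⟩
    (if partsIn S α then 1/j! ℚ.* 1/!ᵛ α else 0ℚ)
  ≡⟨ cong (λ v → if partsIn S α then v else 0ℚ)
          (/-*-/ 1 (suc j !) 1 (α !ᵛ) {{ suc j ℕP.!≢0 }} {{ !ᵛ≢0 α }}) ⟩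
    (if partsIn S α then 1/!ᵛ (suc j ∷ α) else 0ℚ) ∎
  where
  open ≡-Reasoning
  1/j! : ℚ
  1/j! = _/_ (+ 1) (suc j !) {{ suc j ℕP.!≢0 }}

count/n≡1/!ᵛ : ∀ c n e {k} (α : Vec ℕ k) .{{_ : ℕ.NonZero n}} →
  c ℕ.* α !ᵛ ≡ (if e then n else 0) → (+ c) / n ≡ (if e then 1/!ᵛ α else 0ℚ)
count/n≡1/!ᵛ c n true  α eq = /-cross c n 1 (α !ᵛ) (trans eq (sym (ℕP.+-identityʳ n)))
  where instance _ = !ᵛ≢0 α
count/n≡1/!ᵛ c n false α eq rewrite ℕP.m*n≡0⇒m≡0 c (α !ᵛ) {{ !ᵛ≢0 α }} eq = ℚP.0/n≡0 n

Yseq-closed : ∀ S n {m} (α : Vec ℕ m) → Yseq S n m α ≡ prodSeedClosed (seedS S) (n ∷ α)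
Yseq-closed S zero        α = oneSer-closed refl α
Yseq-closed S (suc d) {m} α = begin
    (+ Ycoeff S (suc d) m α) / suc d !
  ≡⟨ cong (λ y → (+ y) / suc d !) (Ycoeff-countMaps S (suc d) α) ⟩
    (+ (if partsIn S α then countMaps (suc d) α else 0)) / suc d !
  ≡⟨ restrict (partsIn S α) ⟩
    (if suc d ≡ᵇ Vec.sum α then (if partsIn S α then 1/!ᵛ α else 0ℚ) else 0ℚ)
  ≡⟨ cong (λ v → if suc d ≡ᵇ Vec.sum α then v else 0ℚ) (sym (seedS-coeffProduct S α)) ⟩
    prodSeedClosed (seedS S) (suc d ∷ α) ∎
  where
  open ≡-Reasoning
  instance _ = suc d ℕP.!≢0
  restrict : ∀ b → (+ (if b then countMaps (suc d) α else 0)) / suc d !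
                   ≡ (if suc d ≡ᵇ Vec.sum α then (if b then 1/!ᵛ α else 0ℚ) else 0ℚ)
  restrict true  = count/n≡1/!ᵛ (countMaps (suc d) α) (suc d !) (suc d ≡ᵇ Vec.sum α) α
                                (countMaps-multinomial (suc d) α)
  restrict false = trans (ℚP.0/n≡0 (suc d !)) (sym (if-eta (suc d ≡ᵇ Vec.sum α)))

proposition2p5 : (S : ℕ → Bool) → S 0 ≡ false → (∃ λ j → S j ≡ true)
                 → IsSproutSeq (Yseq S) (seedS S)
proposition2p5 S _ _ = refl , (λ _ _ → refl) , λ where
  m (n ∷ α) → trans (Yseq-closed S n α) (sym (prodSeed-closed (seedS S) m (n ∷ α)))
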